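{- Let $n\geq1$, $m\geq1$ and let $v$ be a vertex of $Y_{n,m}$, regarded also as a vertex of $Z_{n,m}$. Then $d_{Z_{n,m}}(v,0)=d_{Y_{n,m}}(v,0)$.
   Context: For integers $n\geq 1$, $m\geq 0$, the Yoke graph $Y_{n,m}$ has vertices the tuples $v=(v_0,\dots,v_{m+1})$ with $v_0,v_{m+1}\in\mathbb{Z}_n$, $v_1,\dots,v_m\in\{0,1\}$ and $\sum_{i}v_i\equiv0\pmod n$; the dYoke graph $Z_{n,m}$ is defined identically but with $v_1,\dots,v_m\in\{ -1,0,1\}$, so every vertex of $Y_{n,m}$ is a vertex of $Z_{n,m}$. In both, $u\sim v$ iff for some $0\leq i\leq m$, $u_j=v_j$ for $j\notin\{i,i+1\}$ and $(u_i,u_{i+1})=(v_i\pm1,v_{i+1}\mp1)$, with bucket coordinates $0,m+1$ computed in $\mathbb{Z}_n$ and entries staying in their allowed sets. $0$ is the all-zero vertex. -}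

module Defs where

open import Data.Nat using (ℕ; zero; suc; _≡ᵇ_) renaming (_≤_ to _≤ℕ_)
open import Data.Bool using (Bool; true; false)
open import Data.Fin using (Fin; zero; suc; toℕ; inject₁)
open import Data.Vec using (Vec; lookup; foldr; replicate)
open import Data.Integer using (ℤ; +_; -_; _+_; _-_; _≤_; _<_; 0ℤ; 1ℤ; -1ℤ)
open import Data.Integer.Divisibility using (_∣_)
open import Data.Product using (Σ; _×_; ∃)
open import Data.Sum using (_⊎_)
open import Relation.Binary.PropositionalEquality using (_≡_; _≢_)

-- Coordinates of a vertex of Y_{n,m} / Z_{n,m}: a vector of length m+2,
-- positions 0 and m+1 are the "buckets" (elements of Z_n, stored by their
-- canonical representative in {0,…,n-1}); positions 1..m are the middle entries.
isBucket : ∀ {m} → Fin (suc (suc m)) → Bool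
isBucket zero = true
isBucket {m} (suc j) = toℕ j ≡ᵇ m

sumℤ : ∀ {k} → Vec ℤ k → ℤ
sumℤ = foldr _ _+_ (+ 0)

AllowedY : ℤ → Set
AllowedY x = (x ≡ 0ℤ) ⊎ (x ≡ 1ℤ)

AllowedZ : ℤ → Set
AllowedZ x = (x ≡ -1ℤ) ⊎ ((x ≡ 0ℤ) ⊎ (x ≡ 1ℤ))

IsVertex : (ℤ → Set) → (n m : ℕ) → Vec ℤ (suc (suc m)) → Set
IsVertex A n m v =
  (∀ j → isBucket j ≡ true → (+ 0 ≤ lookup v j) × (lookup v j < + n)) ×
  (∀ j → isBucket j ≡ false → A (lookup v j)) ×
  ((+ n) ∣ sumℤ v)

Shift : (n m : ℕ) → Fin (suc (suc m)) → ℤ → ℤ → ℤ → Set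
Shift n m j x y s with isBucket j
... | true  = (+ n) ∣ (x - (y + s))
... | false = x ≡ y + s

Adj : (n m : ℕ) → Vec ℤ (suc (suc m)) → Vec ℤ (suc (suc m)) → Set
Adj n m u v = Σ (Fin (suc m)) λ i →
  (∀ j → j ≢ inject₁ i → j ≢ suc i → lookup u j ≡ lookup v j) ×
  ∃ λ s → ((s ≡ 1ℤ) ⊎ (s ≡ -1ℤ)) ×
    Shift n m (inject₁ i) (lookup u (inject₁ i)) (lookup v (inject₁ i)) s ×
    Shift n m (suc i) (lookup u (suc i)) (lookup v (suc i)) (- s)

data Walk {V : Set} (P : V → Set) (R : V → V → Set) : V → V → ℕ → Set where
  here : ∀ {u} → Walk P R u u 0
  step : ∀ {u w v k} → R u w → P w → Walk P R w v k → Walk P R u v (suc k)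

Dist : {V : Set} (P : V → Set) (R : V → V → Set) → V → V → ℕ → Set
Dist P R u v d = Walk P R u v d × (∀ k → Walk P R u v k → d ≤ℕ k)

zeroV : ∀ {m} → Vec ℤ (suc (suc m))
zeroV = replicate _ 0ℤ

-- Lift the bucket coordinate v₀ to ℤ and fix an offset b ∈ nℤ.  The vertex
-- then determines the flows fⱼ = b + v₀ + ⋯ + vⱼ through the edges
-- j = 0, …, m, and a move along edge j changes fⱼ, and no other flow, by ±1
-- (when a bucket wraps around modulo n, b changes by a multiple of n).  So
-- every walk from v to 0, in Y_{n,m} or in Z_{n,m}, has length at least
-- min_b Σⱼ |fⱼ|.  Conversely, from a vertex of Y_{n,m} a greedy walk inside
-- Y_{n,m} lowers Σⱼ |fⱼ| by one at every step: if f₀ < 0 push a chip across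
-- edge 0, unless the next middle entry is 0, in which case f₁ = f₀ and we
-- look further right (symmetrically for f₀ > 0; if f₀ = 0, the next entry
-- decides).  Hence both distances equal min_b Σⱼ |fⱼ|.

module Submission where

open import Defs
open import Data.Bool.Base using (true; false; if_then_else_)
open import Data.Empty using (⊥-elim)
open import Data.Fin.Base using (Fin; zero; suc; toℕ; inject₁; fromℕ)
import Data.Fin.Properties as Fin
open import Data.Integer.Base
  using (ℤ; +_; -[1+_]; -_; _+_; _-_; _*_; ∣_∣; 0ℤ; 1ℤ; -1ℤ; +≤+; +<+)
  renaming (_≤_ to _≤ℤ_; _<_ to _<ℤ_)
import Data.Integer.Properties as ℤ
open import Data.Integer.DivMod using (_/ℕ_; _%ℕ_; n%ℕd<d; a≡a%ℕn+[a/ℕn]*n)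
open import Data.Integer.Divisibility.Signed
  using (_∣_; divides; ∣ᵤ⇒∣; ∣⇒∣ᵤ; ∣m∣n⇒∣m+n; ∣m⇒∣-m; ∣m+n∣m⇒∣n)
open import Data.Integer.Tactic.RingSolver using (solve-∀)
open import Data.Nat.Base
  using (ℕ; zero; suc; _≡ᵇ_; _≤_; _<_; z≤n; s≤s; NonZero; >-nonZero)
  renaming (_+_ to _+ℕ_)
import Data.Nat.Properties as ℕ
import Data.Nat.Tactic.RingSolver as ℕ-Solver
open import Data.Nat.Divisibility using (∣⇒≤)
open import Data.Nat.DivMod using (m<n⇒m%n≡m)
open import Data.Product.Base using (Σ-syntax; ∃-syntax; _×_; _,_; proj₁; proj₂)
open import Data.Sum.Base using (_⊎_; inj₁; inj₂)
open import Data.Unit.Base using (⊤; tt)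
open import Data.Vec.Base using (Vec; []; _∷_; lookup; replicate; tabulate)
open import Data.Vec.Properties using (lookup∘tabulate)
open import Function.Base using (_∘_)
open import Function.Bundles using (_⇔_; mk⇔)
open import Relation.Binary.Definitions using (tri<; tri≈; tri>)
open import Relation.Binary.PropositionalEquality
open import Relation.Nullary using (yes; no)

Walk-map : ∀ {V : Set} {P Q : V → Set} {R : V → V → Set} {u v k} →
           (∀ {x} → P x → Q x) → Walk P R u v k → Walk Q R u v k
Walk-map P⇒Q here              = here
Walk-map P⇒Q (step r p walk) = step r (P⇒Q p) (Walk-map P⇒Q walk)

dist-⇔ : ∀ {V : Set} {P Q : V → Set} {R : V → V → Set} {u v} →
         (∀ {k} → Walk P R u v k → Walk Q R u v k) →
         (∀ {k} → Walk Q R u v k → ∃[ l ] (l ≤ k × Walk P R u v l)) →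
         ∀ d → Dist Q R u v d ⇔ Dist P R u v d
dist-⇔ {_} {P} {Q} {R} {u} {v} P⇒Q shorten d = mk⇔ to from
  where
  to : Dist Q R u v d → Dist P R u v d
  to (walk , minimal) =
    let (l , l≤d , walk′) = shorten walk
    in subst (Walk P R u v) (ℕ.≤-antisym l≤d (minimal l (P⇒Q walk′))) walk′
     , λ k → minimal k ∘ P⇒Q
  from : Dist P R u v d → Dist Q R u v d
  from (walk , minimal) = P⇒Q walk , λ k walk′ →
    let (l , l≤k , walk″) = shorten walk′ in ℕ.≤-trans (minimal l walk″) l≤k

Y-vertex⇒Z-vertex : ∀ {n m v} → IsVertex AllowedY n m v → IsVertex AllowedZ n m v
Y-vertex⇒Z-vertex (buckets , middle , n∣sum) = buckets , (λ p → inj₂ ∘ middle p) , n∣sum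

isBucket-middle : ∀ {m} (j : Fin m) → isBucket (suc (inject₁ j)) ≡ false
isBucket-middle zero    = refl
isBucket-middle (suc j) = isBucket-middle j

isBucket-last : ∀ m → isBucket (fromℕ (suc m)) ≡ true
isBucket-last zero    = refl
isBucket-last (suc m) = isBucket-last m

Sign : ℤ → Set
Sign s = s ≡ 1ℤ ⊎ s ≡ -1ℤ

-‿sign : ∀ {s} → Sign s → Sign (- s)
-‿sign (inj₁ refl) = inj₂ refl
-‿sign (inj₂ refl) = inj₁ refl

∣i+s∣≤1+∣i∣ : ∀ i {s} → Sign s → ∣ i + s ∣ ≤ suc ∣ i ∣
∣i+s∣≤1+∣i∣ i {s} ±s = ℕ.≤-trans (ℤ.∣i+j∣≤∣i∣+∣j∣ i s) (ℕ.≤-reflexive (∣i∣+∣s∣≡1+∣i∣ ±s))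
  where
  ∣i∣+∣s∣≡1+∣i∣ : Sign s → ∣ i ∣ +ℕ ∣ s ∣ ≡ suc ∣ i ∣
  ∣i∣+∣s∣≡1+∣i∣ (inj₁ refl) = ℕ.+-comm ∣ i ∣ 1
  ∣i∣+∣s∣≡1+∣i∣ (inj₂ refl) = ℕ.+-comm ∣ i ∣ 1

i<0⇒1+∣i+1∣≡∣i∣ : ∀ {i} → i <ℤ 0ℤ → suc ∣ i + 1ℤ ∣ ≡ ∣ i ∣
i<0⇒1+∣i+1∣≡∣i∣ { -[1+ zero ]}  _         = refl
i<0⇒1+∣i+1∣≡∣i∣ { -[1+ suc _ ]} _         = refl
i<0⇒1+∣i+1∣≡∣i∣ {+ _}          (+<+ ())

0<i⇒1+∣i-1∣≡∣i∣ : ∀ {i} → 0ℤ <ℤ i → suc ∣ i + -1ℤ ∣ ≡ ∣ i ∣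
0<i⇒1+∣i-1∣≡∣i∣ {+ suc _}  _         = refl
0<i⇒1+∣i-1∣≡∣i∣ {+ zero}   (+<+ ())
0<i⇒1+∣i-1∣≡∣i∣ { -[1+ _ ]} ()

n∣i⇒i≡0 : ∀ {n i} → + n ∣ i → 0ℤ ≤ℤ i → i <ℤ + n → i ≡ 0ℤ
n∣i⇒i≡0 {i = + zero}   _   _ _           = refl
n∣i⇒i≡0 {i = + suc _}  n∣i _ (+<+ 1+i<n) =
  ⊥-elim (ℕ.<-irrefl refl (ℕ.<-≤-trans 1+i<n (∣⇒≤ (∣⇒∣ᵤ n∣i))))
n∣i⇒i≡0 {i = -[1+ _ ]} _   () _

∣-sum : ∀ {d k} (u w : Vec ℤ k) → (∀ p → d ∣ lookup u p - lookup w p) →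
        d ∣ sumℤ u - sumℤ w
∣-sum []       []       _   = divides 0ℤ refl
∣-sum {d} (x ∷ xs) (y ∷ ys) d∣ =
  subst (d ∣_) (regroup x y (sumℤ xs) (sumℤ ys))
    (∣m∣n⇒∣m+n (d∣ zero) (∣-sum xs ys (d∣ ∘ suc)))
  where
  regroup : ∀ x y s t → (x - y) + (s - t) ≡ (x + s) - (y + t)
  regroup = solve-∀

cost : ∀ {r} → ℤ → Vec ℤ (suc r) → ℕ
cost b (x ∷ [])     = 0
cost b (x ∷ y ∷ ys) = ∣ b + x ∣ +ℕ cost (b + x) (y ∷ ys)

flow : ∀ {r} → ℤ → Vec ℤ (suc r) → Fin r → ℤ
flow b (x ∷ xs) zero    = b + x
flow b (x ∷ xs) (suc j) = flow (b + x) xs j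

cost-∷ : ∀ {k} b x (w : Vec ℤ (suc k)) → cost b (x ∷ w) ≡ ∣ b + x ∣ +ℕ cost (b + x) w
cost-∷ b x (y ∷ ys) = refl

cost-cong-head : ∀ {k b b′ x x′} (w : Vec ℤ k) → b + x ≡ b′ + x′ →
                 cost b (x ∷ w) ≡ cost b′ (x′ ∷ w)
cost-cong-head []       _ = refl
cost-cong-head (y ∷ ys) e = cong (λ c → ∣ c ∣ +ℕ cost c (y ∷ ys)) e

cost-cong-init : ∀ {k} c (xs ys : Vec ℤ (suc k)) →
                 (∀ (j : Fin k) → lookup xs (inject₁ j) ≡ lookup ys (inject₁ j)) →
                 cost c xs ≡ cost c ys
cost-cong-init c (x ∷ [])      (y ∷ [])      _    = refl
cost-cong-init c (x ∷ x′ ∷ xs) (y ∷ y′ ∷ ys) same rewrite same zero =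
  cong (∣ c + y ∣ +ℕ_) (cost-cong-init (c + y) (x′ ∷ xs) (y′ ∷ ys) (same ∘ suc))

cost-zeros : ∀ k → cost 0ℤ (replicate (suc k) 0ℤ) ≡ 0
cost-zeros zero    = refl
cost-zeros (suc k) = cost-zeros k

zerosThen : ∀ {k} → ℤ → Vec ℤ (suc k)
zerosThen {zero}  t = t ∷ []
zerosThen {suc k} t = 0ℤ ∷ zerosThen t

zerosThen-0 : ∀ k → zerosThen {k} 0ℤ ≡ replicate (suc k) 0ℤ
zerosThen-0 zero    = refl
zerosThen-0 (suc k) = cong (0ℤ ∷_) (zerosThen-0 k)

lookup-zerosThen-last : ∀ k t → lookup (zerosThen {k} t) (fromℕ k) ≡ t
lookup-zerosThen-last zero    t = refl
lookup-zerosThen-last (suc k) t = lookup-zerosThen-last k t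

sum-zerosThen : ∀ k t → sumℤ (zerosThen {k} t) ≡ t
sum-zerosThen zero    t = ℤ.+-identityʳ t
sum-zerosThen (suc k) t = trans (ℤ.+-identityˡ _) (sum-zerosThen k t)

cost-0≡0⇒zerosThen : ∀ {k} (w : Vec ℤ (suc k)) → cost 0ℤ w ≡ 0 → ∃[ t ] w ≡ zerosThen t
cost-0≡0⇒zerosThen (t ∷ [])      _  = t , refl
cost-0≡0⇒zerosThen (y ∷ y′ ∷ ys) c≡0 =
  let (t , eq) = cost-0≡0⇒zerosThen (y′ ∷ ys) (subst (λ c → cost c (y′ ∷ ys) ≡ 0) 0+y≡0
                   (ℕ.m+n≡0⇒n≡0 ∣ 0ℤ + y ∣ c≡0))
  in t , cong₂ _∷_ (trans (sym (ℤ.+-identityˡ y)) 0+y≡0) eq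
  where
  0+y≡0 : 0ℤ + y ≡ 0ℤ
  0+y≡0 = ℤ.∣i∣≡0⇒i≡0 (ℕ.m+n≡0⇒m≡0 ∣ 0ℤ + y ∣ c≡0)

move : ∀ {r} → Fin r → ℤ → Vec ℤ (suc r) → Vec ℤ (suc r)
move zero    s (x ∷ y ∷ ys) = x + s ∷ y - s ∷ ys
move (suc j) s (x ∷ xs)     = x ∷ move j s xs

lookup-move-inject₁ : ∀ {r} (v : Vec ℤ (suc r)) j s →
                      lookup (move j s v) (inject₁ j) ≡ lookup v (inject₁ j) + s
lookup-move-inject₁ (x ∷ y ∷ ys) zero    s = refl
lookup-move-inject₁ (x ∷ xs)     (suc j) s = lookup-move-inject₁ xs j s

lookup-move-suc : ∀ {r} (v : Vec ℤ (suc r)) j s →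
                  lookup (move j s v) (suc j) ≡ lookup v (suc j) - s
lookup-move-suc (x ∷ y ∷ ys) zero    s = refl
lookup-move-suc (x ∷ xs)     (suc j) s = lookup-move-suc xs j s

lookup-move-other : ∀ {r} (v : Vec ℤ (suc r)) j s p → p ≢ inject₁ j → p ≢ suc j →
                    lookup (move j s v) p ≡ lookup v p
lookup-move-other (x ∷ y ∷ ys) zero    s zero          p≢j _     = ⊥-elim (p≢j refl)
lookup-move-other (x ∷ y ∷ ys) zero    s (suc zero)    _   p≢1+j = ⊥-elim (p≢1+j refl)
lookup-move-other (x ∷ y ∷ ys) zero    s (suc (suc p)) _   _     = refl
lookup-move-other (x ∷ xs)     (suc j) s zero          _   _     = refl
lookup-move-other (x ∷ xs)     (suc j) s (suc p)       p≢j p≢1+j =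
  lookup-move-other xs j s p (p≢j ∘ cong suc) (p≢1+j ∘ cong suc)

sum-move : ∀ {r} (v : Vec ℤ (suc r)) j s → sumℤ (move j s v) ≡ sumℤ v
sum-move (x ∷ y ∷ ys) zero    s = cancel x y s (sumℤ ys)
  where
  cancel : ∀ x y s t → (x + s) + ((y - s) + t) ≡ x + (y + t)
  cancel = solve-∀
sum-move (x ∷ xs)     (suc j) s = cong (_+_ x) (sum-move xs j s)

cost-move : ∀ {r} b (v : Vec ℤ (suc r)) j s →
            cost b (move j s v) +ℕ ∣ flow b v j ∣ ≡ cost b v +ℕ ∣ flow b v j + s ∣
cost-move b (x ∷ y ∷ ys) zero s = begin
    ∣ b + (x + s) ∣ +ℕ cost (b + (x + s)) (y - s ∷ ys) +ℕ ∣ b + x ∣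
  ≡⟨ cong (λ c → ∣ b + (x + s) ∣ +ℕ c +ℕ ∣ b + x ∣) (cost-cong-head ys (cancel b x y s)) ⟩
    ∣ b + (x + s) ∣ +ℕ cost (b + x) (y ∷ ys) +ℕ ∣ b + x ∣
  ≡⟨ swap-outer ∣ b + (x + s) ∣ _ _ ⟩
    ∣ b + x ∣ +ℕ cost (b + x) (y ∷ ys) +ℕ ∣ b + (x + s) ∣
  ≡⟨ cong (λ c → ∣ b + x ∣ +ℕ cost (b + x) (y ∷ ys) +ℕ ∣ c ∣) (sym (ℤ.+-assoc b x s)) ⟩
    ∣ b + x ∣ +ℕ cost (b + x) (y ∷ ys) +ℕ ∣ b + x + s ∣
  ∎
  where
  open ≡-Reasoning
  cancel : ∀ b x y s → b + (x + s) + (y - s) ≡ b + x + y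
  cancel = solve-∀
  swap-outer : ∀ p c q → p +ℕ c +ℕ q ≡ q +ℕ c +ℕ p
  swap-outer = ℕ-Solver.solve-∀
cost-move b (x ∷ xs) (suc j) s = begin
    cost b (x ∷ move j s xs) +ℕ ∣ f ∣
  ≡⟨ cong (_+ℕ ∣ f ∣) (cost-∷ b x (move j s xs)) ⟩
    ∣ b + x ∣ +ℕ cost (b + x) (move j s xs) +ℕ ∣ f ∣
  ≡⟨ ℕ.+-assoc ∣ b + x ∣ _ _ ⟩
    ∣ b + x ∣ +ℕ (cost (b + x) (move j s xs) +ℕ ∣ f ∣)
  ≡⟨ cong (∣ b + x ∣ +ℕ_) (cost-move (b + x) xs j s) ⟩
    ∣ b + x ∣ +ℕ (cost (b + x) xs +ℕ ∣ f + s ∣)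
  ≡⟨ ℕ.+-assoc ∣ b + x ∣ _ _ ⟨
    ∣ b + x ∣ +ℕ cost (b + x) xs +ℕ ∣ f + s ∣
  ≡⟨ cong (_+ℕ ∣ f + s ∣) (cost-∷ b x xs) ⟨
    cost b (x ∷ xs) +ℕ ∣ f + s ∣
  ∎
  where
  open ≡-Reasoning
  f = flow (b + x) xs j

cost-move-≤ : ∀ {r} b (v : Vec ℤ (suc r)) j {s} → Sign s → cost b (move j s v) ≤ suc (cost b v)
cost-move-≤ b v j {s} ±s = ℕ.+-cancelʳ-≤ ∣ f ∣ _ _ (begin
    cost b (move j s v) +ℕ ∣ f ∣  ≡⟨ cost-move b v j s ⟩
    cost b v +ℕ ∣ f + s ∣         ≤⟨ ℕ.+-monoʳ-≤ (cost b v) (∣i+s∣≤1+∣i∣ f ±s) ⟩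
    cost b v +ℕ suc ∣ f ∣         ≡⟨ ℕ.+-suc (cost b v) ∣ f ∣ ⟩
    suc (cost b v) +ℕ ∣ f ∣       ∎)
  where
  open ℕ.≤-Reasoning
  f = flow b v j

cost-move-descends : ∀ {r} b (v : Vec ℤ (suc r)) j s → suc ∣ flow b v j + s ∣ ≡ ∣ flow b v j ∣ →
                     suc (cost b (move j s v)) ≡ cost b v
cost-move-descends b v j s descends = ℕ.+-cancelʳ-≡ ∣ f + s ∣ _ _ (begin
    suc (cost b (move j s v)) +ℕ ∣ f + s ∣  ≡⟨ ℕ.+-suc _ ∣ f + s ∣ ⟨
    cost b (move j s v) +ℕ suc ∣ f + s ∣    ≡⟨ cong (cost b (move j s v) +ℕ_) descends ⟩
    cost b (move j s v) +ℕ ∣ f ∣            ≡⟨ cost-move b v j s ⟩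
    cost b v +ℕ ∣ f + s ∣                   ∎)
  where
  open ≡-Reasoning
  f = flow b v j

-- The first entry lies in H and the later ones in {0,1}, except the last,
-- which is free.  With H = ⊤ on a vertex: the middle entries lie in {0,1}.
Admissible : ∀ {r} → (ℤ → Set) → Vec ℤ (suc r) → Set
Admissible H (x ∷ [])     = ⊤
Admissible H (x ∷ y ∷ ys) = H x × Admissible AllowedY (y ∷ ys)

admissible-∷ : ∀ {k H x} (w : Vec ℤ (suc k)) → H x → Admissible AllowedY w → Admissible H (x ∷ w)
admissible-∷ (y ∷ ys) hx adm = hx , adm

admissible-init : ∀ {k} (w : Vec ℤ (suc k)) → Admissible AllowedY w →
                  ∀ q → (toℕ q ≡ᵇ k) ≡ false → AllowedY (lookup w q)
admissible-init (y ∷ [])      _          zero    ()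
admissible-init (y ∷ y′ ∷ ys) (ay , _)   zero    _ = ay
admissible-init (y ∷ y′ ∷ ys) (_  , adm) (suc q) e = admissible-init (y′ ∷ ys) adm q e

init-admissible : ∀ {k} (w : Vec ℤ (suc k)) →
                  (∀ (j : Fin k) → AllowedY (lookup w (inject₁ j))) → Admissible AllowedY w
init-admissible (y ∷ [])      _       = tt
init-admissible (y ∷ y′ ∷ ys) allowed = allowed zero , init-admissible (y′ ∷ ys) (allowed ∘ suc)

admissible⇒middle : ∀ {m} (v : Vec ℤ (suc (suc m))) → Admissible (λ _ → ⊤) v →
                    ∀ p → isBucket p ≡ false → AllowedY (lookup v p)
admissible⇒middle (x ∷ y ∷ ys) (_ , adm) (suc q) e = admissible-init (y ∷ ys) adm q e

vertex⇒admissible : ∀ {n m} (v : Vec ℤ (suc (suc m))) → IsVertex AllowedY n m v →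
                    Admissible (λ _ → ⊤) v
vertex⇒admissible (x ∷ y ∷ ys) (_ , middle , _) =
  tt , init-admissible (y ∷ ys) (λ j → middle (suc (inject₁ j)) (isBucket-middle j))

Descent : ∀ {r} → (ℤ → Set) → ℤ → Vec ℤ (suc r) → Set
Descent {r} H b v = Σ[ j ∈ Fin r ] Σ[ s ∈ ℤ ]
  Sign s × Admissible H (move j s v) × suc ∣ flow b v j + s ∣ ≡ ∣ flow b v j ∣

descent-∷ : ∀ {r H} b x (w : Vec ℤ (suc (suc r))) → H x →
            Descent AllowedY (b + x) w → Descent H b (x ∷ w)
descent-∷ b x w hx (j , s , ±s , adm , descends) =
  suc j , s , ±s , admissible-∷ (move j s w) hx adm , descends

descent-up : ∀ {r H} b x (w : Vec ℤ (suc r)) → Admissible H (x ∷ w) → H (x + 1ℤ) →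
             b + x <ℤ 0ℤ → Descent H b (x ∷ w)
descent-up b x (y ∷ [])     _                  hx+1 b+x<0 =
  zero , 1ℤ , inj₁ refl , (hx+1 , tt) , i<0⇒1+∣i+1∣≡∣i∣ b+x<0
descent-up b x (y ∷ z ∷ zs) (_  , inj₂ refl , adm) hx+1 b+x<0 =
  zero , 1ℤ , inj₁ refl , (hx+1 , inj₁ refl , adm) , i<0⇒1+∣i+1∣≡∣i∣ b+x<0
descent-up b x (y ∷ z ∷ zs) (hx , inj₁ refl , adm) _    b+x<0 =
  descent-∷ b x (0ℤ ∷ z ∷ zs) hx (descent-up (b + x) 0ℤ (z ∷ zs) (inj₁ refl , adm) (inj₂ refl)
    (subst (_<ℤ 0ℤ) (sym (ℤ.+-identityʳ (b + x))) b+x<0))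

descent-down : ∀ {r H} b x (w : Vec ℤ (suc r)) → Admissible H (x ∷ w) → H (x + -1ℤ) →
               0ℤ <ℤ b + x → Descent H b (x ∷ w)
descent-down b x (y ∷ [])     _                  hx-1 0<b+x =
  zero , -1ℤ , inj₂ refl , (hx-1 , tt) , 0<i⇒1+∣i-1∣≡∣i∣ 0<b+x
descent-down b x (y ∷ z ∷ zs) (_  , inj₁ refl , adm) hx-1 0<b+x =
  zero , -1ℤ , inj₂ refl , (hx-1 , inj₂ refl , adm) , 0<i⇒1+∣i-1∣≡∣i∣ 0<b+x
descent-down b x (y ∷ z ∷ zs) (hx , inj₂ refl , adm) _    0<b+x =
  descent-∷ b x (1ℤ ∷ z ∷ zs) hx (descent-down (b + x) 1ℤ (z ∷ zs) (inj₂ refl , adm) (inj₁ refl)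
    (ℤ.<-≤-trans 0<b+x (ℤ.i≤i+j (b + x) 1ℤ)))

descent-zero : ∀ {r H} b x (w : Vec ℤ (suc r)) → Admissible H (x ∷ w) → b + x ≡ 0ℤ →
               0 < cost b (x ∷ w) → Descent H b (x ∷ w)
descent-zero b x (y ∷ [])     _ b+x≡0 0<c rewrite b+x≡0 = ⊥-elim (ℕ.<-irrefl refl 0<c)
descent-zero b x (y ∷ z ∷ zs) (hx , inj₁ refl , adm) b+x≡0 0<c =
  descent-∷ b x (0ℤ ∷ z ∷ zs) hx (descent-zero (b + x) 0ℤ (z ∷ zs) (inj₁ refl , adm)
    (trans (ℤ.+-identityʳ (b + x)) b+x≡0)
    (ℕ.<-≤-trans 0<c (ℕ.≤-reflexive (cong (λ c → ∣ c ∣ +ℕ cost (b + x) (0ℤ ∷ z ∷ zs)) b+x≡0))))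
descent-zero b x (y ∷ z ∷ zs) (hx , inj₂ refl , adm) b+x≡0 _ =
  descent-∷ b x (1ℤ ∷ z ∷ zs) hx (descent-down (b + x) 1ℤ (z ∷ zs) (inj₂ refl , adm) (inj₁ refl)
    (subst (λ c → 0ℤ <ℤ c + 1ℤ) (sym b+x≡0) (+<+ (s≤s z≤n))))

descent : ∀ {r} b (v : Vec ℤ (suc (suc r))) → Admissible (λ _ → ⊤) v → 0 < cost b v →
          Descent (λ _ → ⊤) b v
descent b (x ∷ w) adm 0<c with ℤ.<-cmp (b + x) 0ℤ
... | tri< b+x<0 _     _     = descent-up   b x w adm tt b+x<0
... | tri≈ _     b+x≡0 _     = descent-zero b x w adm b+x≡0 0<c
... | tri> _     _     0<b+x = descent-down b x w adm tt 0<b+x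

module _ (n m : ℕ) where

  Agree : Fin (suc (suc m)) → ℤ → ℤ → Set
  Agree p x y with isBucket p
  ... | true  = + n ∣ x - y
  ... | false = x ≡ y

  _≈_ : Vec ℤ (suc (suc m)) → Vec ℤ (suc (suc m)) → Set
  u ≈ w = ∀ p → Agree p (lookup u p) (lookup w p)

  agree-refl : ∀ p x → Agree p x x
  agree-refl p x with isBucket p
  ... | true  = divides 0ℤ (ℤ.+-inverseʳ x)
  ... | false = refl

  agree⇒∣ : ∀ p {x y} → Agree p x y → + n ∣ x - y
  agree⇒∣ p {x} {y} a with isBucket p
  ... | true  = a
  ... | false = divides 0ℤ (trans (cong (_- y) a) (ℤ.+-inverseʳ y))

  agree-middle : ∀ p {x y} → isBucket p ≡ false → Agree p x y → x ≡ y
  agree-middle p e a with isBucket p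
  ... | false = a
  agree-middle p () a | true

  shift⇒agree : ∀ p {x y s} → Shift n m p x y s → Agree p x (y + s)
  shift⇒agree p sh with isBucket p
  ... | true  = ∣ᵤ⇒∣ sh
  ... | false = sh

  adj⇒≈move : ∀ {u w} → Adj n m u w → Σ[ i ∈ Fin (suc m) ] Σ[ s ∈ ℤ ] Sign s × u ≈ move i s w
  adj⇒≈move {u} {w} (i , same , s , ±s , shᵢ , shᵢ₊₁) = i , s , ±s , agree
    where
    agree : u ≈ move i s w
    agree p with p Fin.≟ inject₁ i
    ... | yes refl =
      subst (Agree p (lookup u p)) (sym (lookup-move-inject₁ w i s)) (shift⇒agree p shᵢ)
    ... | no p≢i with p Fin.≟ suc i
    ...   | yes refl =
      subst (Agree p (lookup u p)) (sym (lookup-move-suc w i s)) (shift⇒agree p shᵢ₊₁)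
    ...   | no p≢1+i rewrite lookup-move-other w i s p p≢i p≢1+i | same p p≢i p≢1+i =
      agree-refl p (lookup w p)

  ≈-cost : ∀ {u u′} → u ≈ u′ → ∀ {b} → + n ∣ b → ∃[ b′ ] (+ n ∣ b′ × cost b′ u ≡ cost b u′)
  ≈-cost {x ∷ xs} {x′ ∷ xs′} u≈u′ {b} n∣b = b + (x′ - x) , n∣b′ , (begin
      cost (b + (x′ - x)) (x ∷ xs)
    ≡⟨ cost-∷ _ x xs ⟩
      ∣ b + (x′ - x) + x ∣ +ℕ cost (b + (x′ - x) + x) xs
    ≡⟨ cong (λ c → ∣ c ∣ +ℕ cost c xs) (rebase b x x′) ⟩
      ∣ b + x′ ∣ +ℕ cost (b + x′) xs
    ≡⟨ cong (∣ b + x′ ∣ +ℕ_) (cost-cong-init (b + x′) xs xs′ middle) ⟩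
      ∣ b + x′ ∣ +ℕ cost (b + x′) xs′
    ≡⟨ cost-∷ b x′ xs′ ⟨
      cost b (x′ ∷ xs′)
    ∎)
    where
    open ≡-Reasoning
    rebase : ∀ b x x′ → b + (x′ - x) + x ≡ b + x′
    rebase = solve-∀
    negate : ∀ x x′ → - (x - x′) ≡ x′ - x
    negate = solve-∀
    n∣b′ : + n ∣ b + (x′ - x)
    n∣b′ = ∣m∣n⇒∣m+n n∣b
             (subst (+ n ∣_) (negate x x′) (∣m⇒∣-m (agree⇒∣ zero {x} {x′} (u≈u′ zero))))
    middle : ∀ j → lookup xs (inject₁ j) ≡ lookup xs′ (inject₁ j)
    middle j = agree-middle (suc (inject₁ j)) (isBucket-middle j) (u≈u′ (suc (inject₁ j)))

  ≈-sum : ∀ {u w} → u ≈ w → + n ∣ sumℤ w → + n ∣ sumℤ u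
  ≈-sum {u} {w} u≈w n∣w =
    subst (+ n ∣_) (cancel (sumℤ u) (sumℤ w))
      (∣m∣n⇒∣m+n (∣-sum u w (λ p → agree⇒∣ p {lookup u p} {lookup w p} (u≈w p))) n∣w)
    where
    cancel : ∀ s t → s - t + t ≡ s
    cancel = solve-∀

  cost-adj : ∀ {u w b} → Adj n m u w → + n ∣ b → ∃[ b′ ] (+ n ∣ b′ × cost b′ u ≤ suc (cost b w))
  cost-adj {u} {w} adj n∣b =
    let (i , s , ±s , u≈) = adj⇒≈move {u} {w} adj
        (b′ , n∣b′ , c≡) = ≈-cost {u} {move i s w} u≈ n∣b
    in b′ , n∣b′ , ℕ.≤-trans (ℕ.≤-reflexive c≡) (cost-move-≤ _ w i ±s)

  walk⇒cost : ∀ {P u k} → Walk P (Adj n m) u zeroV k → ∃[ b ] (+ n ∣ b × cost b u ≤ k)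
  walk⇒cost here                 = 0ℤ , divides 0ℤ refl , ℕ.≤-reflexive (cost-zeros (suc m))
  walk⇒cost {u = u} (step {w = w} adj _ walk) =
    let (b , n∣b , c≤k)    = walk⇒cost walk
        (b′ , n∣b′ , c′≤) = cost-adj {u} {w} adj n∣b
    in b′ , n∣b′ , ℕ.≤-trans c′≤ (s≤s c≤k)

  zerosThen-vertex : ∀ {A t} → IsVertex A n m (zerosThen t) → t ≡ 0ℤ
  zerosThen-vertex {t = t} (inRange , _ , n∣sum) =
    let (0≤t , t<n) = subst (λ x → 0ℤ ≤ℤ x × x <ℤ + n) (lookup-zerosThen-last (suc m) t)
                        (inRange (fromℕ (suc m)) (isBucket-last m))
    in n∣i⇒i≡0 (subst (+ n ∣_) (sum-zerosThen (suc m) t) (∣ᵤ⇒∣ n∣sum)) 0≤t t<n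

  cost≡0⇒zero : ∀ {A b} v → IsVertex A n m v → + n ∣ b → cost b v ≡ 0 → v ≡ zeroV
  cost≡0⇒zero {A} {b} (x ∷ w) v-vertex n∣b c≡0 =
    let (t , w≡) = cost-0≡0⇒zerosThen w
                     (subst (λ c → cost c w ≡ 0) b+x≡0 (ℕ.m+n≡0⇒n≡0 ∣ b + x ∣ c≡0′))
        v≡ = cong₂ _∷_ x≡0 w≡
        t≡0 = zerosThen-vertex {A} {t} (subst (IsVertex A n m) v≡ v-vertex)
    in trans v≡ (trans (cong (zerosThen {suc m}) t≡0) (zerosThen-0 (suc m)))
    where
    c≡0′ : ∣ b + x ∣ +ℕ cost (b + x) w ≡ 0
    c≡0′ = trans (sym (cost-∷ b x w)) c≡0
    b+x≡0 : b + x ≡ 0ℤ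
    b+x≡0 = ℤ.∣i∣≡0⇒i≡0 (ℕ.m+n≡0⇒m≡0 ∣ b + x ∣ c≡0′)
    x≡0 : x ≡ 0ℤ
    x≡0 = let (0≤x , x<n) = proj₁ v-vertex zero refl
          in n∣i⇒i≡0 (∣m+n∣m⇒∣n (divides 0ℤ b+x≡0) n∣b) 0≤x x<n

  module _ {{_ : NonZero n}} where

    reduce : ℤ → ℤ
    reduce z = + (z %ℕ n)

    reduce-range : ∀ z → 0ℤ ≤ℤ reduce z × reduce z <ℤ + n
    reduce-range z = +≤+ z≤n , +<+ (n%ℕd<d z n)

    n∣reduce-z : ∀ z → + n ∣ reduce z - z
    n∣reduce-z z = divides (- (z /ℕ n)) (begin
        reduce z - z                                ≡⟨ cong (_-_ (reduce z)) (a≡a%ℕn+[a/ℕn]*n z n) ⟩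
        reduce z - (reduce z + (z /ℕ n) * + n)     ≡⟨ cancel (reduce z) (z /ℕ n) (+ n) ⟩
        - (z /ℕ n) * + n                            ∎)
      where
      open ≡-Reasoning
      cancel : ∀ r q d → r - (r + q * d) ≡ - q * d
      cancel = solve-∀

    reduce-id : ∀ {z} → 0ℤ ≤ℤ z → z <ℤ + n → reduce z ≡ z
    reduce-id {+ _} _ (+<+ z<n) = cong +_ (m<n⇒m%n≡m z<n)

    reduceAt : Fin (suc (suc m)) → ℤ → ℤ
    reduceAt p z = if isBucket p then reduce z else z

    reduceAt-id : ∀ p {z} → (isBucket p ≡ true → 0ℤ ≤ℤ z × z <ℤ + n) → reduceAt p z ≡ z
    reduceAt-id p inRange with isBucket p
    ... | true  = let (0≤z , z<n) = inRange refl in reduce-id 0≤z z<n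
    ... | false = refl

    shift-reduceAt : ∀ p {x z t} → x ≡ z + t → Shift n m p x (reduceAt p z) t
    shift-reduceAt p {x} {z} {t} x≡z+t with isBucket p
    ... | true  = ∣⇒∣ᵤ (subst (+ n ∣_) eq (∣m⇒∣-m (n∣reduce-z z)))
      where
      rearrange : ∀ r z t → - (r - z) ≡ (z + t) - (r + t)
      rearrange = solve-∀
      eq : - (reduce z - z) ≡ x - (reduce z + t)
      eq = trans (rearrange (reduce z) z t) (cong (_- (reduce z + t)) (sym x≡z+t))
    ... | false = x≡z+t

    reduceBuckets : Vec ℤ (suc (suc m)) → Vec ℤ (suc (suc m))
    reduceBuckets u = tabulate λ p → reduceAt p (lookup u p)

    lookup-reduceBuckets : ∀ u p → lookup (reduceBuckets u) p ≡ reduceAt p (lookup u p)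
    lookup-reduceBuckets u = lookup∘tabulate (λ p → reduceAt p (lookup u p))

    reduceBuckets-≈ : ∀ u → reduceBuckets u ≈ u
    reduceBuckets-≈ u p rewrite lookup-reduceBuckets u p with isBucket p
    ... | true  = n∣reduce-z (lookup u p)
    ... | false = refl

    reduceBuckets-vertex : ∀ {u} → Admissible (λ _ → ⊤) u → + n ∣ sumℤ u →
                           IsVertex AllowedY n m (reduceBuckets u)
    reduceBuckets-vertex {u} adm n∣sum =
      buckets , middle , ∣⇒∣ᵤ (≈-sum {reduceBuckets u} {u} (reduceBuckets-≈ u) n∣sum)
      where
      buckets : ∀ p → isBucket p ≡ true →
                0ℤ ≤ℤ lookup (reduceBuckets u) p × lookup (reduceBuckets u) p <ℤ + n
      buckets p e rewrite lookup-reduceBuckets u p | e = reduce-range (lookup u p)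
      middle : ∀ p → isBucket p ≡ false → AllowedY (lookup (reduceBuckets u) p)
      middle p e rewrite lookup-reduceBuckets u p | e = admissible⇒middle u adm p e

    adj-reduce-move : ∀ {A v} j {s} → IsVertex A n m v → Sign s →
                      Adj n m v (reduceBuckets (move j s v))
    adj-reduce-move {v = v} j {s} (inRange , _ , _) ±s = j , same , - s , -‿sign ±s , shⱼ , shⱼ₊₁
      where
      open ≡-Reasoning
      w = reduceBuckets (move j s v)
      undo : ∀ x s → x ≡ x + s + - s
      undo = solve-∀
      same : ∀ p → p ≢ inject₁ j → p ≢ suc j → lookup v p ≡ lookup w p
      same p p≢j p≢1+j = begin
        lookup v p                          ≡⟨ reduceAt-id p (inRange p) ⟨
        reduceAt p (lookup v p)             ≡⟨ cong (reduceAt p) (lookup-move-other v j s p p≢j p≢1+j) ⟨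
        reduceAt p (lookup (move j s v) p)  ≡⟨ lookup-reduceBuckets (move j s v) p ⟨
        lookup w p                          ∎
      shⱼ : Shift n m (inject₁ j) (lookup v (inject₁ j)) (lookup w (inject₁ j)) (- s)
      shⱼ rewrite lookup-reduceBuckets (move j s v) (inject₁ j) | lookup-move-inject₁ v j s =
        shift-reduceAt (inject₁ j) (undo (lookup v (inject₁ j)) s)
      shⱼ₊₁ : Shift n m (suc j) (lookup v (suc j)) (lookup w (suc j)) (- - s)
      shⱼ₊₁ rewrite lookup-reduceBuckets (move j s v) (suc j) | lookup-move-suc v j s =
        shift-reduceAt (suc j) (undo (lookup v (suc j)) (- s))

    greedy-step : ∀ {b} v → IsVertex AllowedY n m v → + n ∣ b → 0 < cost b v →
                  Σ[ w ∈ Vec ℤ (suc (suc m)) ] Σ[ b′ ∈ ℤ ]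
                    Adj n m v w × IsVertex AllowedY n m w × + n ∣ b′ × suc (cost b′ w) ≡ cost b v
    greedy-step {b} v v-vertex n∣b 0<c =
      let (j , s , ±s , adm , descends) = descent b v (vertex⇒admissible v v-vertex) 0<c
          u = move j s v
          (b′ , n∣b′ , c≡) = ≈-cost {reduceBuckets u} {u} (reduceBuckets-≈ u) n∣b
          n∣sum = subst (+ n ∣_) (sym (sum-move v j s)) (∣ᵤ⇒∣ (proj₂ (proj₂ v-vertex)))
      in reduceBuckets u , b′ , adj-reduce-move {AllowedY} {v} j v-vertex ±s ,
         reduceBuckets-vertex {u} adm n∣sum , n∣b′ ,
         trans (cong suc c≡) (cost-move-descends b v j s descends)

    cost⇒walk : ∀ k {b} v → IsVertex AllowedY n m v → + n ∣ b → cost b v ≡ k →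
                Walk (IsVertex AllowedY n m) (Adj n m) v zeroV k
    cost⇒walk zero    v v-vertex n∣b c≡0 =
      subst (λ u → Walk (IsVertex AllowedY n m) (Adj n m) u zeroV 0)
            (sym (cost≡0⇒zero {AllowedY} v v-vertex n∣b c≡0)) here
    cost⇒walk (suc k) v v-vertex n∣b c≡1+k =
      let (w , b′ , adj , w-vertex , n∣b′ , c≡) =
            greedy-step v v-vertex n∣b (ℕ.<-≤-trans (s≤s z≤n) (ℕ.≤-reflexive (sym c≡1+k)))
      in step adj w-vertex (cost⇒walk k w w-vertex n∣b′ (ℕ.suc-injective (trans c≡ c≡1+k)))

    shorten : ∀ {P k} v → IsVertex AllowedY n m v → Walk P (Adj n m) v zeroV k →
              ∃[ l ] (l ≤ k × Walk (IsVertex AllowedY n m) (Adj n m) v zeroV l)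
    shorten v v-vertex walk =
      let (b , n∣b , c≤k) = walk⇒cost walk
      in cost b v , c≤k , cost⇒walk (cost b v) v v-vertex n∣b refl

corollary5p33 : (n m : ℕ) → 1 ≤ n → 1 ≤ m → (v : Vec ℤ (suc (suc m))) →
                  IsVertex AllowedY n m v → (d : ℕ) →
                  Dist (IsVertex AllowedZ n m) (Adj n m) v zeroV d ⇔
                    Dist (IsVertex AllowedY n m) (Adj n m) v zeroV d
corollary5p33 n m 1≤n _ v v-vertex =
  dist-⇔ (Walk-map (λ {v} → Y-vertex⇒Z-vertex {n} {m} {v})) (shorten n m {{>-nonZero 1≤n}} v v-vertex)
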